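{- Let $\Omega=(S,\Sigma,\Pi)$ be a many-sorted signature, let $\mathcal{S}$ be a set of ground atoms over $\Omega$, let $\mathcal{I}=\mathcal{I}_{\mathcal{S}}$ be its initial model, and for every model $\mathcal{A}$ of $\mathcal{S}$ let $h=\{h_s:\mathcal{I}_s\to\mathcal{A}_s\}_{s\in S}$ be the unique $\Omega$-homomorphism from $\mathcal{I}$ to $\mathcal{A}$. Let $\varphi$ be a sentence of the form $$(Q_1 x_1:s_1)\cdots(Q_k x_k:s_k)\ \bigvee_{i=1}^m\bigwedge_{j=1}^{n_i} L_{ij},$$ where each $L_{ij}$ is a literal, $x_1,\ldots,x_k$ ($k\ge 0$) are the variables occurring in these literals, of sorts $s_1,\ldots,s_k$, and each $Q_q\in\{\forall,\exists\}$. Let $\mathcal{A}$ be a model of $\mathcal{S}$ such that (a) for every $q$ with $1\le q\le k$ and $Q_q=\forall$, the map $h_{s_q}$ is surjective; and (b) for every negative literal $L_{ij}=\neg P(t_1,\ldots,t_n)$ of $\varphi$, with $P\in\Pi_w$, and every substitution $\sigma$ mapping each variable to a ground term of its sort, if $h(\sigma(t_1),\ldots,\sigma(t_n))\in P^{\mathcal{A}}$ then $(\sigma(t_1),\ldots,\sigma(t_n))\in P^{\mathcal{I}}$. Then $\mathcal{I}_{\mathcal{S}}\models\varphi$ implies $\mathcal{A}\models\varphi$.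
   Context: Many-sorted first-order logic: a signature $\Omega=(S,\Sigma,\Pi)$ consists of a set $S$ of sorts, function symbols $f:s_1\cdots s_k\to s$ (constants when $k=0$), and predicate symbols $P\in\Pi_w$ with $w\in S^+$; if the identity predicate $=\,:ss$ is present, every structure interprets it as the identity on the carrier of sort $s$. An $\Omega$-structure $\mathcal{A}$ has a carrier $\mathcal{A}_s$ for each sort, a function $f^{\mathcal{A}}$ for each function symbol, and a relation $P^{\mathcal{A}}\subseteq\mathcal{A}_w$ for each predicate. An $\Omega$-homomorphism $h:\mathcal{A}\to\mathcal{A}'$ is a sort-indexed family of maps commuting with all function symbols and mapping tuples in $P^{\mathcal{A}}$ into $P^{\mathcal{A}'}$. The initial model $\mathcal{I}_{\mathcal{S}}$ of a set $\mathcal{S}$ of ground atoms has, for each sort $s$, the set of ground terms of sort $s$ modulo the least congruence $\sim$ generated by the ground equations in $\mathcal{S}$ (just the ground terms if $\mathcal{S}$ has no equations), function symbols interpreted syntactically, and $P^{\mathcal{I}}$ the set of tuples of classes of ground terms $(t_1,\ldots,t_n)$ such that $P(t'_1,\ldots,t'_n)\in\mathcal{S}$ for some $t'_i\sim t_i$. For any model $\mathcal{A}$ of $\mathcal{S}$ the unique homomorphism $h:\mathcal{I}_{\mathcal{S}}\to\mathcal{A}$ sends the class of a ground term $t$ to the value of $t$ in $\mathcal{A}$. For a substitution $\sigma$ of ground terms, $\sigma(t)$ is regarded as an element (class) of $\mathcal{I}$. A literal is an atom (positive) or the negation of an atom (negative). -}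

module Defs where

open import Data.List using (List; []; _∷_; map)
open import Data.List.Relation.Unary.All as All using (All; []; _∷_)
open import Data.List.Relation.Unary.Any using (Any)
open import Data.List.Membership.Propositional using (_∈_)
open import Data.Product using (Σ; ∃; _×_; _,_; proj₁; proj₂)
open import Data.Bool using (Bool; true)
open import Relation.Nullary using (¬_)
open import Relation.Binary.PropositionalEquality using (_≡_)
open import Relation.Binary.Structures using (IsEquivalence)

-- Many-sorted signatures Ω = (S, Σ, Π).
-- hasEq = true means the identity predicate (=:ss for every sort s) is
-- present; it is treated as a logical symbol, interpreted as the
-- (setoid) identity of each structure.

record Signature : Set₁ where
  field
    Sort   : Set
    Fun    : Set
    arity  : Fun → List Sort
    res    : Fun → Sort
    Pred   : Set
    parity : Pred → List Sort
    hasEq  : Bool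

data Pw {S : Set} {A : S → Set} (R : ∀ {s} → A s → A s → Set)
     : ∀ {l} → All A l → All A l → Set where
  []  : Pw R [] []
  _∷_ : ∀ {s l a b as bs} → R {s} a b → Pw R {l} as bs → Pw R {s ∷ l} (a ∷ as) (b ∷ bs)

data Quant : Set where
  ∀q ∃q : Quant

module _ (Ω : Signature) where
  open Signature Ω

  -- Terms with variables from context Γ (variables are de Bruijn
  -- positions in Γ, each carrying its sort).  Ground terms: Term [] s.
  data Term (Γ : List Sort) : Sort → Set where
    var : ∀ {s} → s ∈ Γ → Term Γ s
    app : (f : Fun) → All (Term Γ) (arity f) → Term Γ (res f)

  -- Ω-structures, with carriers given as setoids (so that the initial
  -- model, a quotient, can be represented without quotient types).
  record Structure : Set₁ where
    field
      Car             : Sort → Set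
      _≈_             : ∀ {s} → Car s → Car s → Set
      ≈-isEquivalence : ∀ {s} → IsEquivalence (_≈_ {s})
      fun             : (f : Fun) → All Car (arity f) → Car (res f)
      fun-cong        : ∀ f {as bs} → Pw _≈_ as bs → fun f as ≈ fun f bs
      rel             : (P : Pred) → All Car (parity P) → Set
      rel-resp        : ∀ P {as bs} → Pw _≈_ as bs → rel P as → rel P bs

  module _ (A : Structure) where
    open Structure A

    eval  : ∀ {Γ s} → All Car Γ → Term Γ s → Car s
    evals : ∀ {Γ l} → All Car Γ → All (Term Γ) l → All Car l
    eval ρ (var x)    = All.lookup ρ x
    eval ρ (app f ts) = fun f (evals ρ ts)
    evals ρ []        = []
    evals ρ (t ∷ ts)  = eval ρ t ∷ evals ρ ts

  data Atom (Γ : List Sort) : Set where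
    pred : (P : Pred) → All (Term Γ) (parity P) → Atom Γ
    equ  : hasEq ≡ true → ∀ {s} → Term Γ s → Term Γ s → Atom Γ

  data Literal (Γ : List Sort) : Set where
    pos neg : Atom Γ → Literal Γ

  GroundAtom : Set
  GroundAtom = Atom []

  module _ (A : Structure) where
    open Structure A

    holdsAtom : ∀ {Γ} → All Car Γ → Atom Γ → Set
    holdsAtom ρ (pred P ts)  = rel P (evals A ρ ts)
    holdsAtom ρ (equ _ t u)  = eval A ρ t ≈ eval A ρ u

    holdsLit : ∀ {Γ} → All Car Γ → Literal Γ → Set
    holdsLit ρ (pos α) = holdsAtom ρ α
    holdsLit ρ (neg α) = ¬ holdsAtom ρ α

  -- Sentences (Q₁ x₁:s₁)⋯(Q_k x_k:s_k) ⋁_i ⋀_j L_ij.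
  -- The matrix is in context [s₁, …, s_k]; x_q is the q-th position.
  record Sentence : Set where
    field
      prefix : List (Quant × Sort)
      matrix : List (List (Literal (map proj₂ prefix)))
  open Sentence public

  module _ (A : Structure) where
    open Structure A

    satPrefix : (pre : List (Quant × Sort)) → (All Car (map proj₂ pre) → Set) → Set
    satPrefix []              K = K []
    satPrefix ((∀q , s) ∷ pre) K = (a : Car s) → satPrefix pre (λ ρ → K (a ∷ ρ))
    satPrefix ((∃q , s) ∷ pre) K = Σ (Car s) λ a → satPrefix pre (λ ρ → K (a ∷ ρ))

    Sat : Sentence → Set
    Sat φ = satPrefix (prefix φ) (λ ρ → Any (All (holdsLit A ρ)) (matrix φ))

    IsModel : (GroundAtom → Set) → Set
    IsModel 𝒮 = ∀ α → 𝒮 α → holdsAtom A [] α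

    -- the homomorphism h : ℐ → 𝒜, sending the class of t to its value
    h : ∀ {s} → Term [] s → Car s
    h t = eval A [] t

  module _ (𝒮 : GroundAtom → Set) where

    data _~_ : ∀ {s} → Term [] s → Term [] s → Set where
      ax      : ∀ {s} {t u : Term [] s} (e : hasEq ≡ true) → 𝒮 (equ e t u) → t ~ u
      ~refl   : ∀ {s} {t : Term [] s} → t ~ t
      ~sym    : ∀ {s} {t u : Term [] s} → t ~ u → u ~ t
      ~trans  : ∀ {s} {t u v : Term [] s} → t ~ u → u ~ v → t ~ v
      ~cong   : ∀ f {ts us} → Pw _~_ ts us → app f ts ~ app f us

    IRel : (P : Pred) → All (Term []) (parity P) → Set
    IRel P ts = Σ (All (Term []) (parity P)) λ us → 𝒮 (pred P us) × Pw _~_ us ts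

    private
      pw-trans : ∀ {l} {as bs cs : All (Term []) l} → Pw _~_ as bs → Pw _~_ bs cs → Pw _~_ as cs
      pw-trans [] [] = []
      pw-trans (p ∷ ps) (q ∷ qs) = ~trans p q ∷ pw-trans ps qs

    Initial : Structure
    Initial = record
      { Car             = Term []
      ; _≈_             = _~_
      ; ≈-isEquivalence = record { refl = ~refl ; sym = ~sym ; trans = ~trans }
      ; fun             = app
      ; fun-cong        = ~cong
      ; rel             = IRel
      ; rel-resp        = λ { P p (us , s∈ , q) → us , s∈ , pw-trans q p }
      }

  module _ (𝒮 : GroundAtom → Set) (A : Structure) where
    open Structure A

    HSurjective : Sort → Set
    HSurjective s = (a : Car s) → Σ (Term [] s) λ t → h A t ≈ a

    ConditionA : Sentence → Set
    ConditionA φ = ∀ s → (∀q , s) ∈ prefix φ → HSurjective s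

    NegCond : ∀ {Γ} → Atom Γ → All (Term []) Γ → Set
    NegCond (pred P ts) σ =
      rel P (All.map (h A) (evals (Initial 𝒮) σ ts)) → IRel 𝒮 P (evals (Initial 𝒮) σ ts)
    NegCond (equ _ t u) σ =
      h A (eval (Initial 𝒮) σ t) ≈ h A (eval (Initial 𝒮) σ u) →
      _~_ 𝒮 (eval (Initial 𝒮) σ t) (eval (Initial 𝒮) σ u)

    ConditionB : Sentence → Set
    ConditionB φ = ∀ α → Any (neg α ∈_) (matrix φ) →
                   (σ : All (Term []) (map proj₂ (prefix φ))) → NegCond α σ

module Submission where

-- Let h be the evaluation of ground terms in 𝒜, i.e. the homomorphism ℐ → 𝒜.
-- The proof follows the shape of the sentence from the inside out.
--  * h is compatible with ℐ: it respects the congruence ~ generated by 𝒮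
--    (`h-sound`), and commutes with substitution, h(σ(t)) = t⟦h∘σ⟧
--    (`h-subst`).  Satisfaction in 𝒜 only depends on the environment up to
--    the setoid equality of 𝒜 (`literal-resp`).
--  * Literals: a positive literal true in ℐ under σ is true in 𝒜 under h∘σ,
--    because h is a homomorphism and 𝒜 ⊨ 𝒮; for a negative literal this is
--    exactly what hypothesis (b) provides (`literal-transfer`).  Hence the
--    quantifier-free matrix transfers (`matrix-transfer`).
--  * Quantifier prefix: an existential witness t in ℐ becomes h(t) in 𝒜; a
--    universal statement in ℐ covers every a in 𝒜 because, by hypothesis (a),
--    a = h(t) for some ground term t (`prefix-transfer`).

open import Defs
open import Data.List using (List; []; _∷_; map)
open import Data.List.Relation.Unary.All as All using (All; []; _∷_)
open import Data.List.Relation.Unary.Any using (Any; here; there)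
open import Data.List.Membership.Propositional using (_∈_; find; lose)
open import Data.Product using (_×_; _,_; proj₂)
open import Relation.Binary.PropositionalEquality
  using (_≡_; refl; sym; trans; cong; cong₂; subst; subst₂)
open import Relation.Binary.Structures using (IsEquivalence)

module Invariance (Ω : Signature) (A : Structure Ω) where
  open Signature Ω
  open Structure A
  private module ≈ {s} = IsEquivalence (≈-isEquivalence {s})

  pw-sym : ∀ {l} {ρ ρ′ : All Car l} → Pw _≈_ ρ ρ′ → Pw _≈_ ρ′ ρ
  pw-sym []       = []
  pw-sym (p ∷ ps) = ≈.sym p ∷ pw-sym ps

  pw-lookup : ∀ {l s} {ρ ρ′ : All Car l} → Pw _≈_ ρ ρ′ →
              (x : s ∈ l) → All.lookup ρ x ≈ All.lookup ρ′ x
  pw-lookup (p ∷ ps) (here refl) = p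
  pw-lookup (p ∷ ps) (there x)   = pw-lookup ps x

  eval-resp  : ∀ {Γ s} {ρ ρ′ : All Car Γ} → Pw _≈_ ρ ρ′ →
               (t : Term Ω Γ s) → eval Ω A ρ t ≈ eval Ω A ρ′ t
  evals-resp : ∀ {Γ l} {ρ ρ′ : All Car Γ} → Pw _≈_ ρ ρ′ →
               (ts : All (Term Ω Γ) l) → Pw _≈_ (evals Ω A ρ ts) (evals Ω A ρ′ ts)
  eval-resp ρ≈ρ′ (var x)    = pw-lookup ρ≈ρ′ x
  eval-resp ρ≈ρ′ (app f ts) = fun-cong f (evals-resp ρ≈ρ′ ts)
  evals-resp ρ≈ρ′ []        = []
  evals-resp ρ≈ρ′ (t ∷ ts)  = eval-resp ρ≈ρ′ t ∷ evals-resp ρ≈ρ′ ts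

  atom-resp : ∀ {Γ} {ρ ρ′ : All Car Γ} → Pw _≈_ ρ ρ′ →
              (α : Atom Ω Γ) → holdsAtom Ω A ρ α → holdsAtom Ω A ρ′ α
  atom-resp ρ≈ρ′ (pred P ts) holds = rel-resp P (evals-resp ρ≈ρ′ ts) holds
  atom-resp ρ≈ρ′ (equ _ t u) t≈u   =
    ≈.trans (≈.sym (eval-resp ρ≈ρ′ t)) (≈.trans t≈u (eval-resp ρ≈ρ′ u))

  literal-resp : ∀ {Γ} {ρ ρ′ : All Car Γ} → Pw _≈_ ρ ρ′ →
                 (L : Literal Ω Γ) → holdsLit Ω A ρ L → holdsLit Ω A ρ′ L
  literal-resp ρ≈ρ′ (pos α) holds         = atom-resp ρ≈ρ′ α holds
  literal-resp ρ≈ρ′ (neg α) ¬holds holds′ = ¬holds (atom-resp (pw-sym ρ≈ρ′) α holds′)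

module Transfer (Ω : Signature) (𝒮 : GroundAtom Ω → Set)
                (A : Structure Ω) (model : IsModel Ω A 𝒮) where
  open Signature Ω
  open Structure A
  open Invariance Ω A
  private module ≈ {s} = IsEquivalence (≈-isEquivalence {s})

  I : Structure Ω
  I = Initial Ω 𝒮

  h∘ : ∀ {Γ} → All (Term Ω []) Γ → All Car Γ
  h∘ = All.map (h Ω A)

  lookup-h∘ : ∀ {Γ s} (σ : All (Term Ω []) Γ) (x : s ∈ Γ) →
              All.lookup (h∘ σ) x ≡ h Ω A (All.lookup σ x)
  lookup-h∘ (t ∷ σ) (here refl) = refl
  lookup-h∘ (t ∷ σ) (there x)   = lookup-h∘ σ x

  h-subst  : ∀ {Γ s} (σ : All (Term Ω []) Γ) (t : Term Ω Γ s) →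
             h Ω A (eval Ω I σ t) ≡ eval Ω A (h∘ σ) t
  h-substs : ∀ {Γ l} (σ : All (Term Ω []) Γ) (ts : All (Term Ω Γ) l) →
             evals Ω A [] (evals Ω I σ ts) ≡ evals Ω A (h∘ σ) ts
  h-subst σ (var x)     = sym (lookup-h∘ σ x)
  h-subst σ (app f ts)  = cong (fun f) (h-substs σ ts)
  h-substs σ []         = refl
  h-substs σ (t ∷ ts)   = cong₂ _∷_ (h-subst σ t) (h-substs σ ts)

  map-h≡evals : ∀ {l} (us : All (Term Ω []) l) → All.map (h Ω A) us ≡ evals Ω A [] us
  map-h≡evals []       = refl
  map-h≡evals (u ∷ us) = cong (h Ω A u ∷_) (map-h≡evals us)

  -- h is well defined on ℐ: since 𝒜 ⊨ 𝒮, it identifies ~-equivalent terms.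
  h-sound  : ∀ {s} {t u : Term Ω [] s} → _~_ Ω 𝒮 t u → h Ω A t ≈ h Ω A u
  h-sounds : ∀ {l} {ts us : All (Term Ω []) l} → Pw (_~_ Ω 𝒮) ts us →
             Pw _≈_ (evals Ω A [] ts) (evals Ω A [] us)
  h-sound (ax e t=u∈𝒮)  = model (equ e _ _) t=u∈𝒮
  h-sound ~refl         = ≈.refl
  h-sound (~sym p)      = ≈.sym (h-sound p)
  h-sound (~trans p q)  = ≈.trans (h-sound p) (h-sound q)
  h-sound (~cong f ps)  = fun-cong f (h-sounds ps)
  h-sounds []           = []
  h-sounds (p ∷ ps)     = h-sound p ∷ h-sounds ps

  -- A literal true in ℐ under σ is true in 𝒜 under h∘σ.  Positive literals
  -- transfer because h is a homomorphism into a model of 𝒮; a negative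
  -- literal needs condition (b) for its atom.
  literal-transfer : ∀ {Γ} (σ : All (Term Ω []) Γ) (L : Literal Ω Γ) →
                     (∀ α → L ≡ neg α → NegCond Ω 𝒮 A α σ) →
                     holdsLit Ω I σ L → holdsLit Ω A (h∘ σ) L
  literal-transfer σ (pos (pred P ts)) _ (us , us∈𝒮 , us~σts) =
    subst (rel P) (h-substs σ ts) (rel-resp P (h-sounds us~σts) (model (pred P us) us∈𝒮))
  literal-transfer σ (pos (equ e t u)) _ σt~σu =
    subst₂ _≈_ (h-subst σ t) (h-subst σ u) (h-sound σt~σu)
  literal-transfer σ (neg (pred P ts)) condB ¬inI inA =
    ¬inI (condB _ refl (subst (rel P) (trans (sym (h-substs σ ts)) (sym (map-h≡evals _))) inA))
  literal-transfer σ (neg (equ e t u)) condB ¬σt~σu ht≈hu =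
    ¬σt~σu (condB _ refl (subst₂ _≈_ (sym (h-subst σ t)) (sym (h-subst σ u)) ht≈hu))

  matrix-transfer : ∀ {Γ} (σ : All (Term Ω []) Γ) {ρ : All Car Γ} → Pw _≈_ (h∘ σ) ρ →
                    (m : List (List (Literal Ω Γ))) →
                    (∀ α → Any (neg α ∈_) m → NegCond Ω 𝒮 A α σ) →
                    Any (All (holdsLit Ω I σ)) m → Any (All (holdsLit Ω A ρ)) m
  matrix-transfer σ h∘σ≈ρ m condB satI with find satI
  ... | c , c∈m , clauseI = lose c∈m (All.tabulate literal∈c)
    where
    literal∈c : ∀ {L} → L ∈ c → holdsLit Ω A _ L
    literal∈c {L} L∈c =
      literal-resp h∘σ≈ρ L
        (literal-transfer σ L (λ α L≡¬α → condB α (lose c∈m (subst (_∈ c) L≡¬α L∈c)))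
                          (All.lookup clauseI L∈c))

  -- The quantifier prefix transfers any property of the variable assignment
  -- that transfers along h.  ∃: use the image of the witness; ∀: every
  -- element is the image of a ground term, by (a).
  prefix-transfer : (pre : List (Quant × Sort))
                    (KI : All (Term Ω []) (map proj₂ pre) → Set)
                    (KA : All Car (map proj₂ pre) → Set) →
                    (∀ s → (∀q , s) ∈ pre → HSurjective Ω 𝒮 A s) →
                    (∀ σ {ρ} → Pw _≈_ (h∘ σ) ρ → KI σ → KA ρ) →
                    satPrefix Ω I pre KI → satPrefix Ω A pre KA
  prefix-transfer [] KI KA _ K-transfer satI = K-transfer [] [] satI
  prefix-transfer ((∀q , s) ∷ pre) KI KA surj K-transfer satI a
    with surj s (here refl) a
  ... | t , ht≈a =
    prefix-transfer pre (λ σ → KI (t ∷ σ)) (λ ρ → KA (a ∷ ρ))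
      (λ s′ s′∈pre → surj s′ (there s′∈pre))
      (λ σ h∘σ≈ρ → K-transfer (t ∷ σ) (ht≈a ∷ h∘σ≈ρ)) (satI t)
  prefix-transfer ((∃q , s) ∷ pre) KI KA surj K-transfer (t , satI) =
    h Ω A t ,
    prefix-transfer pre (λ σ → KI (t ∷ σ)) (λ ρ → KA (h Ω A t ∷ ρ))
      (λ s′ s′∈pre → surj s′ (there s′∈pre))
      (λ σ h∘σ≈ρ → K-transfer (t ∷ σ) (≈.refl ∷ h∘σ≈ρ)) satI

theorem1 : (Ω : Signature) (𝒮 : GroundAtom Ω → Set) (φ : Sentence Ω) (A : Structure Ω) →
    IsModel Ω A 𝒮 →
    ConditionA Ω 𝒮 A φ →
    ConditionB Ω 𝒮 A φ →
    Sat Ω (Initial Ω 𝒮) φ →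
    Sat Ω A φ
theorem1 Ω 𝒮 φ A model condA condB satI =
  prefix-transfer (prefix φ) _ _ condA
    (λ σ h∘σ≈ρ → matrix-transfer σ h∘σ≈ρ (matrix φ) (λ α ¬α∈φ → condB α ¬α∈φ σ))
    satI
  where open Transfer Ω 𝒮 A model
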